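{- Let $\mathfrak{G}$ be an alphabet, $\mathcal{P}\subseteq\mathbf{S}(\mathfrak{G})\setminus\{\perp\}$, $\mathtt{a}\in\mathfrak{G}$, and $\mathcal{S}$ a $\mathcal{P}_\mathtt{a}$-consistent word. If $\mathfrak{t}$ is an $\mathcal{S}$-admissible $\mathfrak{G}$-tree, then $\mathfrak{t}$ prefix-avoids $\mathcal{P}_\mathtt{a}$.
   Context: An alphabet is a graded set $\mathfrak{G}=\bigsqcup_{n\ge1}\mathfrak{G}(n)$. A $\mathfrak{G}$-tree is a planar rooted tree whose internal nodes of arity $k$ are labeled by letters of $\mathfrak{G}(k)$; $\mathbf{S}(\mathfrak{G})$ is their set; $\perp$ is the one-leaf tree; if the root has arity $k$, $\mathfrak{t}(i)$ is the subtree rooted at its $i$th child. $\mathfrak{s}$ is a prefix of $\mathfrak{t}$ if $\mathfrak{t}=\mathfrak{s}\circ[\mathfrak{r}_1,\dots,\mathfrak{r}_{|\mathfrak{s}|}]$ for some $\mathfrak{G}$-trees $\mathfrak{r}_j$ (grafting $\mathfrak{r}_j$ on the $j$th leaf of $\mathfrak{s}$); $\mathfrak{t}$ prefix-avoids a set if no element of it is a prefix of $\mathfrak{t}$. For $\mathtt{a}\in\mathfrak{G}(k)$, $\mathcal{P}_\mathtt{a}$ is the set of trees of $\mathcal{P}$ whose root is labeled $\mathtt{a}$. A word $\mathcal{S}=(\mathcal{S}_1,\dots,\mathcal{S}_k)$ of subsets of $\mathbf{S}(\mathfrak{G})$ is $\mathcal{P}_\mathtt{a}$-consistent if for every $\mathfrak{s}\in\mathcal{P}_\mathtt{a}$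 there is $i\in[k]$ with $\mathfrak{s}(i)\ne\perp$ and $\mathfrak{s}(i)\in\mathcal{S}_i$. A $\mathfrak{G}$-tree $\mathfrak{t}$ is $\mathcal{S}$-admissible if its root is labeled $\mathtt{a}$ and for all $i\in[k]$, $\mathfrak{t}(i)$ prefix-avoids $\mathcal{S}_i$. -}

module Defs where

open import Data.Nat using (ℕ; zero; suc; _+_; _≤_)
open import Data.Vec using (Vec; []; _∷_; lookup; splitAt)
open import Data.Fin using (Fin)
open import Data.Product using (Σ; ∃; _×_; _,_)
open import Relation.Binary.PropositionalEquality using (_≡_)
open import Relation.Nullary using (¬_)

record Alphabet : Set₁ where
  field
    Letter    : Set
    arity     : Letter → ℕ
    arity-pos : ∀ a → 1 ≤ arity a

module _ (𝔊 : Alphabet) where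
  open Alphabet 𝔊

  -- 𝔊-trees: ⊥ (leaf) or an internal node labelled by a letter of arity k
  -- with a (planar, ordered) vector of k children.
  data Tree : Set where
    leaf : Tree
    node : (a : Letter) → Vec Tree (arity a) → Tree

  mutual
    leaves : Tree → ℕ
    leaves leaf = 1
    leaves (node a cs) = leavesV cs

    leavesV : ∀ {n} → Vec Tree n → ℕ
    leavesV [] = 0
    leavesV (c ∷ cs) = leaves c + leavesV cs

  mutual
    graft : (s : Tree) → Vec Tree (leaves s) → Tree
    graft leaf (r ∷ []) = r
    graft (node a cs) rs = node a (graftV cs rs)

    graftV : ∀ {n} → (cs : Vec Tree n) → Vec Tree (leavesV cs) → Vec Tree n
    graftV [] [] = []
    graftV (c ∷ cs) rs with splitAt (leaves c) rs
    ... | rs₁ , rs₂ , _ = graft c rs₁ ∷ graftV cs rs₂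

  TreeSet : Set₁
  TreeSet = Tree → Set

  IsPrefix : Tree → Tree → Set
  IsPrefix s t = Σ (Vec Tree (leaves s)) λ rs → graft s rs ≡ t

  PrefixAvoids : TreeSet → Tree → Set
  PrefixAvoids X t = ∀ s → X s → ¬ IsPrefix s t

  data RootIs (a : Letter) : Tree → Set where
    root : (cs : Vec Tree (arity a)) → RootIs a (node a cs)

  child : ∀ {a} (t : Tree) → RootIs a t → Fin (arity a) → Tree
  child (node _ cs) (root .cs) i = lookup cs i

  _at_ : TreeSet → Letter → TreeSet
  (P at a) t = P t × RootIs a t

  Consistent : (P : TreeSet) (a : Letter) → (Fin (arity a) → TreeSet) → Set
  Consistent P a S =
    ∀ s → (p : (P at a) s) →
      let r = Data.Product.proj₂ p in
      ∃ λ i → ¬ (child s r i ≡ leaf) × S i (child s r i)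

  Admissible : (a : Letter) → (Fin (arity a) → TreeSet) → Tree → Set
  Admissible a S t = Σ (RootIs a t) λ r → ∀ i → PrefixAvoids (S i) (child t r i)

module Submission where

-- Grafting acts childwise: if s has root a with children
-- d₁,…,d_k, then s ∘ [r₁,…,r_|s|] has root a and its i-th child is
-- dᵢ grafted with a block of the rᵢ's.  Hence whenever s is a prefix of t
-- and both have root a, every child s(i) is a prefix of the child t(i).
--
-- Now let t be 𝒮-admissible and suppose s ∈ 𝒫_a were a prefix of t.
-- Consistency of 𝒮 provides an index i with s(i) ∈ 𝒮ᵢ; by the childwise
-- fact s(i) is a prefix of t(i), contradicting that t(i) prefix-avoids 𝒮ᵢ.

open import Defs
open import Data.Fin using (Fin; zero; suc)
open import Data.Vec using (Vec; _∷_; lookup; splitAt)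
open import Data.Product using (_,_)
open import Relation.Binary.PropositionalEquality using (_≡_; refl)
open import Relation.Nullary using (¬_)

module _ (𝔊 : Alphabet) where
  open Alphabet 𝔊

  lookup-graftV-isPrefix : ∀ {n} (ds : Vec (Tree 𝔊) n) (rs : Vec (Tree 𝔊) (leavesV 𝔊 ds))
    (i : Fin n) → IsPrefix 𝔊 (lookup ds i) (lookup (graftV 𝔊 ds rs) i)
  lookup-graftV-isPrefix (d ∷ ds) rs i with splitAt (leaves 𝔊 d) rs
  lookup-graftV-isPrefix (d ∷ ds) rs zero    | rs₁ , _   , _ = rs₁ , refl
  lookup-graftV-isPrefix (d ∷ ds) rs (suc i) | _   , rs₂ , _ = lookup-graftV-isPrefix ds rs₂ i

  child-isPrefix : ∀ {a} {s t : Tree 𝔊} (rˢ : RootIs 𝔊 a s) (rᵗ : RootIs 𝔊 a t) →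
    IsPrefix 𝔊 s t → (i : Fin (arity a)) → IsPrefix 𝔊 (child 𝔊 s rˢ i) (child 𝔊 t rᵗ i)
  child-isPrefix (root ds) (root .(graftV 𝔊 ds rs)) (rs , refl) =
    lookup-graftV-isPrefix ds rs

lemma2p2p1 : (𝔊 : Alphabet) (P : TreeSet 𝔊) →
    (∀ t → P t → ¬ (t ≡ leaf)) →
    (a : Alphabet.Letter 𝔊) (S : Fin (Alphabet.arity 𝔊 a) → TreeSet 𝔊) →
    Consistent 𝔊 P a S →
    (t : Tree 𝔊) → Admissible 𝔊 a S t →
    PrefixAvoids 𝔊 (_at_ 𝔊 P a) t
lemma2p2p1 𝔊 P _ a S consistent t (rᵗ , t-avoids) s s∈Pₐ@(_ , rˢ) s-prefix-t
  with consistent s s∈Pₐ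
... | i , _ , sᵢ∈Sᵢ =
  t-avoids i (child 𝔊 s rˢ i) sᵢ∈Sᵢ (child-isPrefix 𝔊 rˢ rᵗ s-prefix-t i)
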